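{- Let $q\ge1$ and $b$ be integers and let $d$ be a positive divisor of $q$. Then $s(q;b)\le\frac{q}{d}\,s(d;b)$.
   Context: For integers $q\ge1$, $b$, $\Lambda_{q,b}=\{(n_1,n_2)\in\mathbb{Z}^2\colon n_1+bn_2\equiv0\bmod q\}$ and $s(q;b)$ is the Euclidean length of a shortest nonzero vector of $\Lambda_{q,b}$. -}

module Defs where

open import Data.Nat using (ℕ; _+_; _*_; _≤_)
open import Data.Integer as ℤ using (ℤ; ∣_∣; +_)
open import Data.Integer.Divisibility using (_∣_)
open import Data.Product using (_×_; Σ; ∃)
open import Relation.Binary.PropositionalEquality using (_≡_)
open import Relation.Nullary using (¬_)

InΛ : ℕ → ℤ → ℤ → ℤ → Set
InΛ q b n₁ n₂ = (+ q) ∣ (n₁ ℤ.+ b ℤ.* n₂)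

NonZeroVec : ℤ → ℤ → Set
NonZeroVec n₁ n₂ = ¬ (n₁ ≡ + 0 × n₂ ≡ + 0)

normSq : ℤ → ℤ → ℕ
normSq n₁ n₂ = ∣ n₁ ∣ * ∣ n₁ ∣ + ∣ n₂ ∣ * ∣ n₂ ∣

-- m is the squared length of a shortest nonzero vector of Λ_{q,b},
-- i.e. m = s(q;b)²
IsShortestSq : ℕ → ℤ → ℕ → Set
IsShortestSq q b m =
  Σ ℤ (λ n₁ → Σ ℤ (λ n₂ → InΛ q b n₁ n₂ × NonZeroVec n₁ n₂ × normSq n₁ n₂ ≡ m))
  × (∀ n₁ n₂ → InΛ q b n₁ n₂ → NonZeroVec n₁ n₂ → m ≤ normSq n₁ n₂)

-- Scaling a vector of Λ_{d,b} by k lands in Λ_{kd,b}, multiplies the squared length by k², and keeps it nonzero;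
-- applied to a shortest vector of Λ_{d,b} this gives s(kd;b) ≤ k s(d;b).

module Submission where

open import Defs
open import Data.Nat using (ℕ; _*_; _≤_)
open import Data.Nat.Divisibility using (_∣_; divides)
import Data.Nat as ℕ
import Data.Nat.Properties as ℕ
open import Data.Integer as ℤ using (ℤ; +_; 0ℤ)
import Data.Integer.Properties as ℤ
import Data.Integer.Divisibility as ℤ
open import Data.Product using (_,_)
open import Relation.Binary.PropositionalEquality using (_≡_; refl; sym; trans; subst; subst₂)
open import Data.Nat.Solver using (module +-*-Solver)
open import Data.Integer.Solver using () renaming (module +-*-Solver to ℤ-Solver)

InΛ-scale : ∀ k {d b n₁ n₂} → InΛ d b n₁ n₂ → InΛ (k * d) b (+ k ℤ.* n₁) (+ k ℤ.* n₂)
InΛ-scale k {d} {b} {n₁} {n₂} d∣n =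
  subst₂ ℤ._∣_ (sym (ℤ.pos-* k d)) (sym (linear (+ k) n₁ n₂ b)) (ℤ.*-monoʳ-∣ (+ k) d∣n)
  where
  open ℤ-Solver
  linear : ∀ k n₁ n₂ b → k ℤ.* n₁ ℤ.+ b ℤ.* (k ℤ.* n₂) ≡ k ℤ.* (n₁ ℤ.+ b ℤ.* n₂)
  linear = solve 4 (λ k n₁ n₂ b → k :* n₁ :+ b :* (k :* n₂) := k :* (n₁ :+ b :* n₂)) refl

+k*i≡0⇒i≡0 : ∀ k .{{_ : ℕ.NonZero k}} {i} → + k ℤ.* i ≡ 0ℤ → i ≡ 0ℤ
+k*i≡0⇒i≡0 k {i} eq = ℤ.*-cancelˡ-≡ (+ k) i 0ℤ (trans eq (sym (ℤ.*-zeroʳ (+ k))))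

NonZeroVec-scale : ∀ k .{{_ : ℕ.NonZero k}} {n₁ n₂} →
  NonZeroVec n₁ n₂ → NonZeroVec (+ k ℤ.* n₁) (+ k ℤ.* n₂)
NonZeroVec-scale k nz (e₁ , e₂) = nz (+k*i≡0⇒i≡0 k e₁ , +k*i≡0⇒i≡0 k e₂)

normSq-scale : ∀ k n₁ n₂ → normSq (+ k ℤ.* n₁) (+ k ℤ.* n₂) ≡ k * k * normSq n₁ n₂
normSq-scale k n₁ n₂ rewrite ℤ.abs-* (+ k) n₁ | ℤ.abs-* (+ k) n₂ =
  solve 3 (λ k a c → k :* a :* (k :* a) :+ k :* c :* (k :* c) := k :* k :* (a :* a :+ c :* c))
    refl k ℤ.∣ n₁ ∣ ℤ.∣ n₂ ∣
  where open +-*-Solver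

shortestSq-*-≤ : ∀ k .{{_ : ℕ.NonZero k}} {d b m m′} →
  IsShortestSq (k * d) b m → IsShortestSq d b m′ → m ≤ k * k * m′
shortestSq-*-≤ k {b = b} {m} (_ , minimal) ((n₁ , n₂ , n∈Λ , n≢0 , refl) , _) =
  subst (m ≤_) (normSq-scale k n₁ n₂)
    (minimal _ _ (InΛ-scale k {b = b} n∈Λ) (NonZeroVec-scale k n≢0))

lemma2p2 : (q : ℕ) → 1 ≤ q → (b : ℤ) → (d : ℕ) → 1 ≤ d → d ∣ q →
    (m m′ : ℕ) → IsShortestSq q b m → IsShortestSq d b m′ →
    m * (d * d) ≤ (q * q) * m′
lemma2p2 _ 1≤q b d _ (divides k refl) m m′ shortest-q shortest-d =
  begin
    m * (d * d)            ≤⟨ ℕ.*-monoˡ-≤ (d * d) (shortestSq-*-≤ k {d} {b} shortest-q shortest-d) ⟩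
    k * k * m′ * (d * d)   ≡⟨ regroup k d m′ ⟩
    (k * d) * (k * d) * m′ ∎
  where
  open ℕ.≤-Reasoning
  instance
    k≢0 : ℕ.NonZero k
    k≢0 = ℕ.m*n≢0⇒m≢0 k {{ℕ.>-nonZero 1≤q}}
  regroup : ∀ k d m′ → k * k * m′ * (d * d) ≡ (k * d) * (k * d) * m′
  regroup = solve 3 (λ k d m′ → k :* k :* m′ :* (d :* d) := (k :* d) :* (k :* d) :* m′) refl
    where open +-*-Solver
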